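{- The set $\{\gamma(w): w \text{ a nanoword over }\alpha\}$ is equal to the commutator subgroup $[\Pi,\Pi]$ of $\Pi$.
   Context: Fix a set $\alpha$ with involution $\tau$. A nanoword over $\alpha$ is a pair $(\mathcal{A},w)$ where $\mathcal{A}$ is a finite set with a map $A\mapsto|A|\in\alpha$ and $w:\{1,\dots,n\}\to\mathcal{A}$ is a word in which each letter of $\mathcal{A}$ occurs exactly twice. Let $\Pi$ be the group with generators $\{z_a\}_{a\in\alpha}$ and defining relations $z_az_{\tau(a)}=1$ for $a\in\alpha$. For a nanoword $w$ of length $n$ and $i=1,\dots,n$, set $\gamma_i=z_{|w(i)|}$ if $w(j)\neq w(i)$ for all $j<i$ (first occurrence), and $\gamma_i=z_{\tau(|w(i)|)}$ otherwise; put $\gamma(w)=\gamma_1\cdots\gamma_n\in\Pi$ (for the empty nanoword, $\gamma=1$). -}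

module Defs where

open import Data.Nat using (ℕ)
open import Data.Bool using (Bool; true; false; not)
open import Data.Product using (_×_; _,_)
open import Data.List using (List; []; _∷_; _++_; length; filter; reverse; map)
open import Data.Fin using (Fin)
open import Data.Fin.Properties using (_≟_)
open import Relation.Nullary using (yes; no)
open import Relation.Binary.PropositionalEquality using (_≡_)
import Data.List.Membership.DecPropositional as DecMem

-- The group Π = ⟨ z_a (a ∈ α) | z_a z_{τ a} = 1 ⟩, presented concretely.
-- Elements are represented by words in the free group on α:
-- a letter (true , a) stands for z_a, a letter (false , a) for z_a⁻¹.
-- Equality in Π is the setoid relation _≈Π_ below.

Letter : Set → Set
Letter α = Bool × α

FWord : Set → Set
FWord α = List (Letter α)

z : {α : Set} → α → FWord α
z a = (true , a) ∷ []

invW : {α : Set} → FWord α → FWord α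
invW w = reverse (map (λ { (b , a) → (not b , a) }) w)

data _≈Π_ {α : Set} (τ : α → α) : FWord α → FWord α → Set where
  ≈-refl  : ∀ {u} → _≈Π_ τ u u
  ≈-sym   : ∀ {u v} → _≈Π_ τ u v → _≈Π_ τ v u
  ≈-trans : ∀ {u v w} → _≈Π_ τ u v → _≈Π_ τ v w → _≈Π_ τ u w
  ≈-free  : ∀ u v b a →
            _≈Π_ τ (u ++ (b , a) ∷ (not b , a) ∷ v) (u ++ v)
  ≈-rel   : ∀ u v a →
            _≈Π_ τ (u ++ (true , a) ∷ (true , τ a) ∷ v) (u ++ v)

commW : {α : Set} → FWord α → FWord α → FWord α
commW x y = x ++ y ++ invW x ++ invW y

data InCommutatorSubgroup {α : Set} (τ : α → α) : FWord α → Set where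
  cs-one  : InCommutatorSubgroup τ []
  cs-comm : ∀ x y → InCommutatorSubgroup τ (commW x y)
  cs-mul  : ∀ {u v} → InCommutatorSubgroup τ u → InCommutatorSubgroup τ v →
            InCommutatorSubgroup τ (u ++ v)
  cs-inv  : ∀ {u} → InCommutatorSubgroup τ u → InCommutatorSubgroup τ (invW u)
  cs-resp : ∀ {u v} → _≈Π_ τ u v → InCommutatorSubgroup τ u →
            InCommutatorSubgroup τ v

-- Nanowords over α.  The finite alphabet 𝒜 is taken to be Fin m
-- (every finite set is in bijection with some Fin m, and γ only
-- depends on the labelled word up to such a bijection).

occ : {m : ℕ} → Fin m → List (Fin m) → ℕ
occ A w = length (filter (A ≟_) w)

record Nanoword (α : Set) : Set where
  field
    m     : ℕ
    label : Fin m → α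
    word  : List (Fin m)
    twice : ∀ (A : Fin m) → occ A word ≡ 2

module _ {α : Set} (τ : α → α) where

  γaux : {m : ℕ} → (Fin m → α) → List (Fin m) → List (Fin m) → FWord α
  γaux {m} lbl seen [] = []
  γaux {m} lbl seen (A ∷ w) with DecMem._∈?_ (_≟_ {m}) A seen
  ... | yes _ = z (τ (lbl A)) ++ γaux lbl (A ∷ seen) w
  ... | no  _ = z (lbl A) ++ γaux lbl (A ∷ seen) w

  γ : Nanoword α → FWord α
  γ nw = γaux (Nanoword.label nw) [] (Nanoword.word nw)

-- A nanoword in which the letter A occurs first is A q A r, and its γ is
-- z_a Q z_a⁻¹ R = [z_a , Q] · Q R, where Q R is γ of the shorter nanoword q r;
-- by induction every γ(w) is a product of commutators.  Conversely, the set of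
-- realised elements contains 1, is closed under products (juxtapose nanowords on
-- disjoint alphabets) and under conjugation by a generator (w ↦ A w A), and
-- contains [z_a , z_b] (the nanoword A B A B).  The identities
-- [x u , y] = x [u , y] x⁻¹ · [x , y] and [x , u y] = [x , u] · u [x , y] u⁻¹
-- then give every commutator by induction on the lengths of its arguments.

module Submission where

open import Defs
open import Data.Bool using (true; false; not)
open import Data.Bool.Properties using (not-involutive)
open import Data.Empty using (⊥-elim)
open import Data.Fin using (Fin; _↑ˡ_; _↑ʳ_; splitAt)
import Data.Fin as Fin
open import Data.Fin.Properties
  using (_≟_; suc-injective; ↑ˡ-injective; ↑ʳ-injective; splitAt-↑ˡ; splitAt-↑ʳ; splitAt⁻¹-↑ˡ; splitAt⁻¹-↑ʳ)
open import Data.List using (List; []; _∷_; _++_; [_]; length; filter; reverse; map)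
open import Data.List.Properties
  using (++-assoc; ++-identityʳ; ++-monoid; unfold-reverse; length-++; length-++-sucʳ; map-id;
         filter-accept; filter-reject; filter-++; filter-some; filter-none)
open import Data.List.Membership.Propositional using (_∈_; _∉_)
open import Data.List.Membership.Propositional.Properties using (∈-++⁺ˡ; ∈-++⁺ʳ; ∈-++⁻; ∈-map⁻; ∈-∃++)
import Data.List.Membership.DecPropositional as DecMembership
open import Data.List.Relation.Unary.Any using (here; there)
open import Data.List.Relation.Unary.Any.Properties using (reverse⁻)
open import Data.List.Relation.Unary.All.Properties using (¬Any⇒All¬)
open import Data.Nat using (ℕ; suc; _+_; _≤_; _<_; s≤s)
open import Data.Nat.Properties using (≤-refl; ≤-trans; n≤1+n; <-irrefl; +-suc)
  renaming (suc-injective to ℕ-suc-injective)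
open import Data.Product using (Σ; _×_; _,_; proj₁)
import Data.Product as Product
import Relation.Binary.Reasoning.Setoid
open import Data.Sum using (_⊎_; inj₁; inj₂)
open import Data.Vec.Functional using () renaming (_∷_ to _∷ᵛ_; _++_ to _++ᵛ_)
open import Data.Vec.Functional.Properties using (lookup-++ˡ; lookup-++ʳ)
open import Function.Base using (id)
open import Level using (0ℓ)
open import Function.Bundles using (_⇔_; mk⇔; Equivalence)
open import Function.Definitions using (Injective)
open import Relation.Binary.Bundles using (Setoid)
open import Relation.Binary.PropositionalEquality
  using (_≡_; _≢_; refl; sym; trans; cong; cong₂; subst; subst₂; module ≡-Reasoning)
open import Relation.Nullary using (Dec; yes; no)
open import Tactic.MonoidSolver using (solve)

open Equivalence using (to; from)

-- Occurrence counts

module _ {m : ℕ} where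

  occ-∷-≡ : ∀ (A : Fin m) w → occ A (A ∷ w) ≡ suc (occ A w)
  occ-∷-≡ A w = cong length (filter-accept (A ≟_) refl)

  occ-∷-≢ : ∀ {A B : Fin m} → A ≢ B → ∀ w → occ A (B ∷ w) ≡ occ A w
  occ-∷-≢ {A} A≢B w = cong length (filter-reject (A ≟_) A≢B)

  occ-++ : ∀ (A : Fin m) x y → occ A (x ++ y) ≡ occ A x + occ A y
  occ-++ A x y = trans (cong length (filter-++ (A ≟_) x y)) (length-++ (filter (A ≟_) x))

  occ≡0⇒∉ : ∀ {A : Fin m} {w} → occ A w ≡ 0 → A ∉ w
  occ≡0⇒∉ {A} occ≡0 A∈w = <-irrefl refl (subst (0 <_) occ≡0 (filter-some (A ≟_) A∈w))

  occ≡suc⇒∈ : ∀ {A : Fin m} {w k} → occ A w ≡ suc k → A ∈ w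
  occ≡suc⇒∈ {A} {w} occ≡suc with DecMembership._∈?_ _≟_ A w
  ... | yes A∈w = A∈w
  ... | no  A∉w with () ← trans (sym occ≡suc) (cong length (filter-none (A ≟_) (¬Any⇒All¬ w A∉w)))

  occ-pair-≡ : ∀ (A : Fin m) q r → occ A (A ∷ q ++ A ∷ r) ≡ suc (suc (occ A (q ++ r)))
  occ-pair-≡ A q r = begin
    occ A (A ∷ q ++ A ∷ r)         ≡⟨ occ-∷-≡ A (q ++ A ∷ r) ⟩
    suc (occ A (q ++ A ∷ r))       ≡⟨ cong suc (occ-++ A q (A ∷ r)) ⟩
    suc (occ A q + occ A (A ∷ r))  ≡⟨ cong (λ k → suc (occ A q + k)) (occ-∷-≡ A r) ⟩
    suc (occ A q + suc (occ A r))  ≡⟨ cong suc (+-suc (occ A q) (occ A r)) ⟩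
    suc (suc (occ A q + occ A r))  ≡⟨ cong (λ k → suc (suc k)) (occ-++ A q r) ⟨
    suc (suc (occ A (q ++ r)))     ∎
    where open ≡-Reasoning

  occ-pair-≢ : ∀ {A B : Fin m} → B ≢ A → ∀ q r → occ B (A ∷ q ++ A ∷ r) ≡ occ B (q ++ r)
  occ-pair-≢ {A} {B} B≢A q r = begin
    occ B (A ∷ q ++ A ∷ r)     ≡⟨ occ-∷-≢ B≢A (q ++ A ∷ r) ⟩
    occ B (q ++ A ∷ r)         ≡⟨ occ-++ B q (A ∷ r) ⟩
    occ B q + occ B (A ∷ r)    ≡⟨ cong (occ B q +_) (occ-∷-≢ B≢A r) ⟩
    occ B q + occ B r          ≡⟨ occ-++ B q r ⟨
    occ B (q ++ r)             ∎
    where open ≡-Reasoning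

module _ {m m′ : ℕ} {f : Fin m → Fin m′} where

  occ-map-injective : Injective _≡_ _≡_ f → ∀ A w → occ (f A) (map f w) ≡ occ A w
  occ-map-injective f-inj A [] = refl
  occ-map-injective f-inj A (B ∷ w) = by-cases (A ≟ B)
    where
    by-cases : Dec (A ≡ B) → occ (f A) (map f (B ∷ w)) ≡ occ A (B ∷ w)
    by-cases (yes refl) = trans (occ-∷-≡ (f A) (map f w))
                            (trans (cong suc (occ-map-injective f-inj A w)) (sym (occ-∷-≡ A w)))
    by-cases (no A≢B)   = trans (occ-∷-≢ (λ e → A≢B (f-inj e)) (map f w))
                            (trans (occ-map-injective f-inj A w) (sym (occ-∷-≢ A≢B w)))

  occ-map-∉-image : ∀ {A} → (∀ B → A ≢ f B) → ∀ w → occ A (map f w) ≡ 0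
  occ-map-∉-image A∉img []      = refl
  occ-map-∉-image A∉img (B ∷ w) = trans (occ-∷-≢ (A∉img B) (map f w)) (occ-map-∉-image A∉img w)

TwiceOrAbsent : ∀ {m} → List (Fin m) → Set
TwiceOrAbsent w = ∀ B → occ B w ≡ 0 ⊎ occ B w ≡ 2

twiceOrAbsent-removePair : ∀ {m} {A : Fin m} {q r} → TwiceOrAbsent (A ∷ q ++ A ∷ r) →
                           occ A (q ++ r) ≡ 0 × TwiceOrAbsent (q ++ r)
twiceOrAbsent-removePair {A = A} {q} {r} twice = occA≡0 , twice′
  where
  occA≡0 : occ A (q ++ r) ≡ 0
  occA≡0 with twice A
  ... | inj₁ zero≡ with () ← trans (sym (occ-pair-≡ A q r)) zero≡
  ... | inj₂ two≡  = ℕ-suc-injective (ℕ-suc-injective (trans (sym (occ-pair-≡ A q r)) two≡))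
  twice′ : TwiceOrAbsent (q ++ r)
  twice′ B with B ≟ A
  ... | yes refl = inj₁ occA≡0
  ... | no  B≢A  = subst (λ k → k ≡ 0 ⊎ k ≡ 2) (occ-pair-≢ B≢A q r) (twice B)

↑ˡ≢↑ʳ : ∀ {m₁ m₂} (i : Fin m₁) (j : Fin m₂) → i ↑ˡ m₂ ≢ m₁ ↑ʳ j
↑ˡ≢↑ʳ {m₁} {m₂} i j eq
  with () ← trans (sym (splitAt-↑ˡ m₁ i m₂)) (trans (cong (splitAt m₁) eq) (splitAt-↑ʳ m₁ m₂ j))

↑ʳ∉map↑ˡ : ∀ {m₁ m₂} (j : Fin m₂) (w : List (Fin m₁)) → m₁ ↑ʳ j ∉ map (_↑ˡ m₂) w
↑ʳ∉map↑ˡ {m₁} {m₂} j w j∈ with i , _ , eq ← ∈-map⁻ (λ (i : Fin m₁) → i ↑ˡ m₂) j∈ = ↑ˡ≢↑ʳ i j (sym eq)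

-- Nanoword constructions

module _ {α : Set} where

  emptyNanoword : Nanoword α
  emptyNanoword = record { m = 0 ; label = λ () ; word = [] ; twice = λ () }

  crossing : α → α → Nanoword α
  crossing c d = record
    { m = 2 ; label = c ∷ᵛ (d ∷ᵛ λ ()) ; word = A ∷ B ∷ A ∷ B ∷ [] ; twice = twice }
    where
    A B : Fin 2
    A = Fin.zero
    B = Fin.suc Fin.zero
    twice : ∀ C → occ C (A ∷ B ∷ A ∷ B ∷ []) ≡ 2
    twice Fin.zero           = refl
    twice (Fin.suc Fin.zero) = refl

  wrap : α → Nanoword α → Nanoword α
  wrap c w = record
    { m = suc m ; label = c ∷ᵛ label ; word = Fin.zero ∷ map Fin.suc word ++ Fin.zero ∷ [] ; twice = twice′ }
    where
    open Nanoword w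
    word-++-[] : map Fin.suc word ++ [] ≡ map Fin.suc word
    word-++-[] = ++-identityʳ _
    twice′ : ∀ A → occ A (Fin.zero ∷ map Fin.suc word ++ Fin.zero ∷ []) ≡ 2
    twice′ Fin.zero = trans (occ-pair-≡ Fin.zero (map Fin.suc word) [])
      (cong (λ k → suc (suc k))
        (trans (cong (occ Fin.zero) word-++-[]) (occ-map-∉-image (λ B ()) word)))
    twice′ (Fin.suc i) = trans (occ-pair-≢ {A = Fin.zero} (λ ()) (map Fin.suc word) [])
      (trans (cong (occ (Fin.suc i)) word-++-[])
        (trans (occ-map-injective suc-injective i word) (twice i)))

  infixr 5 _⊕_
  _⊕_ : Nanoword α → Nanoword α → Nanoword α
  w₁ ⊕ w₂ = record
    { m = m₁ + m₂ ; label = N₁.label ++ᵛ N₂.label ; word = word ; twice = twice }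
    where
    module N₁ = Nanoword w₁
    module N₂ = Nanoword w₂
    m₁ = N₁.m
    m₂ = N₂.m
    word : List (Fin (m₁ + m₂))
    word = map (_↑ˡ m₂) N₁.word ++ map (m₁ ↑ʳ_) N₂.word
    twice-↑ˡ : ∀ i → occ (i ↑ˡ m₂) word ≡ 2
    twice-↑ˡ i = trans (occ-++ (i ↑ˡ m₂) (map (_↑ˡ m₂) N₁.word) _)
      (cong₂ _+_ (trans (occ-map-injective (↑ˡ-injective m₂ _ _) i N₁.word) (N₁.twice i))
                 (occ-map-∉-image (↑ˡ≢↑ʳ i) N₂.word))
    twice-↑ʳ : ∀ j → occ (m₁ ↑ʳ j) word ≡ 2
    twice-↑ʳ j = trans (occ-++ (m₁ ↑ʳ j) (map (_↑ˡ m₂) N₁.word) _)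
      (cong₂ _+_ (occ-map-∉-image (λ i eq → ↑ˡ≢↑ʳ i j (sym eq)) N₁.word)
                 (trans (occ-map-injective (↑ʳ-injective m₁ _ _) j N₂.word) (N₂.twice j)))
    twice : ∀ A → occ A word ≡ 2
    twice A with splitAt m₁ A in eq
    ... | inj₁ i = subst (λ B → occ B word ≡ 2) (splitAt⁻¹-↑ˡ eq) (twice-↑ˡ i)
    ... | inj₂ j = subst (λ B → occ B word ≡ 2) (splitAt⁻¹-↑ʳ eq) (twice-↑ʳ j)

-- Words in Π

module _ {α : Set} (τ : α → α) where

  infix 4 _≈_
  _≈_ : FWord α → FWord α → Set
  _≈_ = _≈Π_ τ

  ≈-setoid : Setoid 0ℓ 0ℓ
  ≈-setoid = record
    { Carrier = FWord α ; _≈_ = _≈_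
    ; isEquivalence = record { refl = ≈-refl ; sym = ≈-sym ; trans = ≈-trans } }

  module ≈-Reasoning = Relation.Binary.Reasoning.Setoid ≈-setoid

  ++-congˡ : ∀ (p : FWord α) {u v} → u ≈ v → p ++ u ≈ p ++ v
  ++-congˡ p ≈-refl           = ≈-refl
  ++-congˡ p (≈-sym e)        = ≈-sym (++-congˡ p e)
  ++-congˡ p (≈-trans e e′)   = ≈-trans (++-congˡ p e) (++-congˡ p e′)
  ++-congˡ p (≈-free u v b a) = subst₂ _≈_ (++-assoc p u _) (++-assoc p u v) (≈-free (p ++ u) v b a)
  ++-congˡ p (≈-rel u v a)    = subst₂ _≈_ (++-assoc p u _) (++-assoc p u v) (≈-rel (p ++ u) v a)

  ++-congʳ : ∀ (q : FWord α) {u v} → u ≈ v → u ++ q ≈ v ++ q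
  ++-congʳ q ≈-refl           = ≈-refl
  ++-congʳ q (≈-sym e)        = ≈-sym (++-congʳ q e)
  ++-congʳ q (≈-trans e e′)   = ≈-trans (++-congʳ q e) (++-congʳ q e′)
  ++-congʳ q (≈-free u v b a) = subst₂ _≈_ (sym (++-assoc u _ q)) (sym (++-assoc u v q)) (≈-free u (v ++ q) b a)
  ++-congʳ q (≈-rel u v a)    = subst₂ _≈_ (sym (++-assoc u _ q)) (sym (++-assoc u v q)) (≈-rel u (v ++ q) a)

  ++-cong : ∀ {u u′ v v′} → u ≈ u′ → v ≈ v′ → u ++ v ≈ u′ ++ v′
  ++-cong {u′ = u′} {v = v} e e′ = ≈-trans (++-congʳ v e) (++-congˡ u′ e′)

  ≈-free⁻ : ∀ (p q : FWord α) b a → p ++ (not b , a) ∷ (b , a) ∷ q ≈ p ++ q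
  ≈-free⁻ p q true  a = ≈-free p q false a
  ≈-free⁻ p q false a = ≈-free p q true a

  z⁻¹≈z∘τ : ∀ (p q : FWord α) a → p ++ (false , a) ∷ q ≈ p ++ z (τ a) ++ q
  z⁻¹≈z∘τ p q a = begin
    p ++ (false , a) ∷ q                          ≡⟨ ++-assoc p [ (false , a) ] q ⟨
    (p ++ [ (false , a) ]) ++ q                   ≈⟨ ≈-rel _ q a ⟨
    (p ++ [ (false , a) ]) ++ z a ++ z (τ a) ++ q  ≡⟨ ++-assoc p _ _ ⟩
    p ++ (false , a) ∷ (true , a) ∷ z (τ a) ++ q   ≈⟨ ≈-free p _ false a ⟩
    p ++ z (τ a) ++ q                             ∎
    where open ≈-Reasoning

  invW-∷ : ∀ b (a : α) u → invW ((b , a) ∷ u) ≡ invW u ++ [ (not b , a) ]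
  invW-∷ b a u = unfold-reverse (not b , a) (map (λ { (b , a) → (not b , a) }) u)

  invW-++ : ∀ (u v : FWord α) → invW (u ++ v) ≡ invW v ++ invW u
  invW-++ []            v = sym (++-identityʳ (invW v))
  invW-++ ((b , a) ∷ u) v = begin
    invW ((b , a) ∷ u ++ v)                  ≡⟨ invW-∷ b a (u ++ v) ⟩
    invW (u ++ v) ++ [ (not b , a) ]         ≡⟨ cong (_++ [ (not b , a) ]) (invW-++ u v) ⟩
    (invW v ++ invW u) ++ [ (not b , a) ]    ≡⟨ ++-assoc (invW v) (invW u) _ ⟩
    invW v ++ invW u ++ [ (not b , a) ]      ≡⟨ cong (invW v ++_) (invW-∷ b a u) ⟨
    invW v ++ invW ((b , a) ∷ u)             ∎
    where open ≡-Reasoning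

  invW-involutive : ∀ (u : FWord α) → invW (invW u) ≡ u
  invW-involutive []            = refl
  invW-involutive ((b , a) ∷ u) = begin
    invW (invW ((b , a) ∷ u))                      ≡⟨ cong invW (invW-∷ b a u) ⟩
    invW (invW u ++ [ (not b , a) ])               ≡⟨ invW-++ (invW u) _ ⟩
    (not (not b) , a) ∷ invW (invW u)              ≡⟨ cong₂ (λ c v → (c , a) ∷ v) (not-involutive b) (invW-involutive u) ⟩
    (b , a) ∷ u                                    ∎
    where open ≡-Reasoning

  invW-commW : ∀ (x y : FWord α) → invW (commW x y) ≡ commW y x
  invW-commW x y = begin
    invW (x ++ y ++ invW x ++ invW y)                         ≡⟨ invW-++ x _ ⟩
    invW (y ++ invW x ++ invW y) ++ invW x                    ≡⟨ cong (_++ invW x) (invW-++ y _) ⟩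
    (invW (invW x ++ invW y) ++ invW y) ++ invW x             ≡⟨ cong (λ v → (v ++ invW y) ++ invW x) (invW-++ (invW x) _) ⟩
    ((invW (invW y) ++ invW (invW x)) ++ invW y) ++ invW x    ≡⟨ cong₂ (λ v v′ → ((v ++ v′) ++ invW y) ++ invW x)
                                                                       (invW-involutive y) (invW-involutive x) ⟩
    ((y ++ x) ++ invW y) ++ invW x                            ≡⟨ solve (++-monoid (Letter α)) ⟩
    y ++ x ++ invW y ++ invW x                                ∎
    where open ≡-Reasoning

  invW-cancelˡ : ∀ (p u q : FWord α) → p ++ invW u ++ u ++ q ≈ p ++ q
  invW-cancelˡ p []            q = ≈-refl
  invW-cancelˡ p ((b , a) ∷ u) q = begin
    p ++ invW ((b , a) ∷ u) ++ (b , a) ∷ u ++ q                 ≡⟨ cong (λ v → p ++ v ++ (b , a) ∷ u ++ q) (invW-∷ b a u) ⟩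
    p ++ (invW u ++ [ (not b , a) ]) ++ [ (b , a) ] ++ u ++ q   ≡⟨ solve (++-monoid (Letter α)) ⟩
    (p ++ invW u) ++ [ (not b , a) ] ++ [ (b , a) ] ++ u ++ q   ≈⟨ ≈-free⁻ (p ++ invW u) (u ++ q) b a ⟩
    (p ++ invW u) ++ u ++ q                                     ≡⟨ ++-assoc p _ _ ⟩
    p ++ invW u ++ u ++ q                                       ≈⟨ invW-cancelˡ p u q ⟩
    p ++ q                                                      ∎
    where open ≈-Reasoning

  invW-cancelʳ : ∀ (p u q : FWord α) → p ++ u ++ invW u ++ q ≈ p ++ q
  invW-cancelʳ p u q =
    subst (λ v → p ++ v ++ invW u ++ q ≈ p ++ q) (invW-involutive u) (invW-cancelˡ p (invW u) q)

  invW-inverseʳ : ∀ (u : FWord α) → u ++ invW u ≈ []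
  invW-inverseʳ u = subst (λ v → u ++ v ≈ []) (++-identityʳ (invW u)) (invW-cancelʳ [] u [])

  commW-++-cancel : ∀ (x u v : FWord α) → commW x u ++ u ++ v ≈ x ++ u ++ invW x ++ v
  commW-++-cancel x u v = begin
    (x ++ u ++ invW x ++ invW u) ++ u ++ v    ≡⟨ solve (++-monoid (Letter α)) ⟩
    (x ++ u ++ invW x) ++ invW u ++ u ++ v    ≈⟨ invW-cancelˡ (x ++ u ++ invW x) u v ⟩
    (x ++ u ++ invW x) ++ v                   ≡⟨ solve (++-monoid (Letter α)) ⟩
    x ++ u ++ invW x ++ v                     ∎
    where open ≈-Reasoning

  commW-++ˡ : ∀ (u x y : FWord α) → (u ++ commW x y ++ invW u) ++ commW u y ≈ commW (u ++ x) y
  commW-++ˡ u x y = begin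
    (u ++ (x ++ y ++ invW x ++ invW y) ++ invW u) ++ (u ++ y ++ invW u ++ invW y)
      ≡⟨ solve (++-monoid (Letter α)) ⟩
    (u ++ x ++ y ++ invW x ++ invW y) ++ invW u ++ u ++ (y ++ invW u ++ invW y)
      ≈⟨ invW-cancelˡ (u ++ x ++ y ++ invW x ++ invW y) u (y ++ invW u ++ invW y) ⟩
    (u ++ x ++ y ++ invW x ++ invW y) ++ (y ++ invW u ++ invW y)
      ≡⟨ solve (++-monoid (Letter α)) ⟩
    (u ++ x ++ y ++ invW x) ++ invW y ++ y ++ (invW u ++ invW y)
      ≈⟨ invW-cancelˡ (u ++ x ++ y ++ invW x) y (invW u ++ invW y) ⟩
    (u ++ x ++ y ++ invW x) ++ (invW u ++ invW y)
      ≡⟨ solve (++-monoid (Letter α)) ⟩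
    (u ++ x) ++ y ++ (invW x ++ invW u) ++ invW y
      ≡⟨ cong (λ v → (u ++ x) ++ y ++ v ++ invW y) (invW-++ u x) ⟨
    commW (u ++ x) y
      ∎
    where open ≈-Reasoning

  commW-++ʳ : ∀ (x u y : FWord α) → commW x u ++ (u ++ commW x y ++ invW u) ≈ commW x (u ++ y)
  commW-++ʳ x u y = begin
    (x ++ u ++ invW x ++ invW u) ++ (u ++ (x ++ y ++ invW x ++ invW y) ++ invW u)
      ≡⟨ solve (++-monoid (Letter α)) ⟩
    (x ++ u ++ invW x) ++ invW u ++ u ++ (x ++ y ++ invW x ++ invW y ++ invW u)
      ≈⟨ invW-cancelˡ (x ++ u ++ invW x) u (x ++ y ++ invW x ++ invW y ++ invW u) ⟩
    (x ++ u ++ invW x) ++ (x ++ y ++ invW x ++ invW y ++ invW u)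
      ≡⟨ solve (++-monoid (Letter α)) ⟩
    (x ++ u) ++ invW x ++ x ++ (y ++ invW x ++ invW y ++ invW u)
      ≈⟨ invW-cancelˡ (x ++ u) x (y ++ invW x ++ invW y ++ invW u) ⟩
    (x ++ u) ++ (y ++ invW x ++ invW y ++ invW u)
      ≡⟨ solve (++-monoid (Letter α)) ⟩
    x ++ (u ++ y) ++ invW x ++ (invW y ++ invW u)
      ≡⟨ cong (λ v → x ++ (u ++ y) ++ invW x ++ v) (invW-++ u y) ⟨
    commW x (u ++ y)
      ∎
    where open ≈-Reasoning

  -- The letters of γ

  γletter : ∀ {m} → (Fin m → α) → List (Fin m) → Fin m → FWord α
  γletter l s A with DecMembership._∈?_ _≟_ A s
  ... | yes _ = z (τ (l A))
  ... | no  _ = z (l A)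

  γaux-∷ : ∀ {m} (l : Fin m → α) s A w → γaux τ l s (A ∷ w) ≡ γletter l s A ++ γaux τ l (A ∷ s) w
  γaux-∷ l s A w with DecMembership._∈?_ _≟_ A s
  ... | yes _ = refl
  ... | no  _ = refl

  γletter-∈ : ∀ {m} (l : Fin m → α) {s A} → A ∈ s → γletter l s A ≡ z (τ (l A))
  γletter-∈ l {s} {A} A∈s with DecMembership._∈?_ _≟_ A s
  ... | yes _   = refl
  ... | no  A∉s = ⊥-elim (A∉s A∈s)

  γletter-∉ : ∀ {m} (l : Fin m → α) {s A} → A ∉ s → γletter l s A ≡ z (l A)
  γletter-∉ l {s} {A} A∉s with DecMembership._∈?_ _≟_ A s
  ... | yes A∈s = ⊥-elim (A∉s A∈s)
  ... | no  _   = refl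

  γletter-resp : ∀ {m m′} {l : Fin m → α} {l′ : Fin m′ → α} {s s′ A A′} →
                 A′ ∈ s′ ⇔ A ∈ s → l′ A′ ≡ l A → γletter l′ s′ A′ ≡ γletter l s A
  γletter-resp {l′ = l′} {s = s} {A = A} seen l≡ with DecMembership._∈?_ _≟_ A s
  ... | yes A∈s = trans (γletter-∈ l′ (from seen A∈s)) (cong (λ a → z (τ a)) l≡)
  ... | no  A∉s = trans (γletter-∉ l′ (λ A′∈s′ → A∉s (to seen A′∈s′))) (cong z l≡)

  γaux-++ : ∀ {m} (l : Fin m → α) s x y → γaux τ l s (x ++ y) ≡ γaux τ l s x ++ γaux τ l (reverse x ++ s) y
  γaux-++ l s []      y = refl
  γaux-++ l s (A ∷ x) y = begin
    γaux τ l s (A ∷ x ++ y)                                          ≡⟨ γaux-∷ l s A (x ++ y) ⟩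
    γletter l s A ++ γaux τ l (A ∷ s) (x ++ y)                       ≡⟨ cong (γletter l s A ++_) (γaux-++ l (A ∷ s) x y) ⟩
    γletter l s A ++ γaux τ l (A ∷ s) x ++ γaux τ l (reverse x ++ A ∷ s) y
      ≡⟨ cong (λ t → γletter l s A ++ γaux τ l (A ∷ s) x ++ γaux τ l t y) reverse-∷-++ ⟩
    γletter l s A ++ γaux τ l (A ∷ s) x ++ γaux τ l (reverse (A ∷ x) ++ s) y
      ≡⟨ ++-assoc (γletter l s A) _ _ ⟨
    (γletter l s A ++ γaux τ l (A ∷ s) x) ++ γaux τ l (reverse (A ∷ x) ++ s) y
      ≡⟨ cong (_++ γaux τ l (reverse (A ∷ x) ++ s) y) (γaux-∷ l s A x) ⟨
    γaux τ l s (A ∷ x) ++ γaux τ l (reverse (A ∷ x) ++ s) y          ∎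
    where
    open ≡-Reasoning
    reverse-∷-++ : reverse x ++ A ∷ s ≡ reverse (A ∷ x) ++ s
    reverse-∷-++ = sym (trans (cong (_++ s) (unfold-reverse A x)) (++-assoc (reverse x) [ A ] s))

  γaux-rename : ∀ {m m′} {f : Fin m → Fin m′} → Injective _≡_ _≡_ f →
                {l : Fin m → α} {l′ : Fin m′ → α} → (∀ i → l′ (f i) ≡ l i) →
                ∀ {s s′} w → (∀ {B} → B ∈ w → f B ∈ s′ ⇔ B ∈ s) →
                γaux τ l′ s′ (map f w) ≡ γaux τ l s w
  γaux-rename f-inj l≡ []      seen = refl
  γaux-rename {f = f} f-inj {l} {l′} l≡ {s} {s′} (A ∷ w) seen = begin
    γaux τ l′ s′ (f A ∷ map f w)                      ≡⟨ γaux-∷ l′ s′ (f A) (map f w) ⟩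
    γletter l′ s′ (f A) ++ γaux τ l′ (f A ∷ s′) (map f w)
      ≡⟨ cong₂ _++_ (γletter-resp (seen (here refl)) (l≡ A)) (γaux-rename f-inj l≡ w seen′) ⟩
    γletter l s A ++ γaux τ l (A ∷ s) w               ≡⟨ γaux-∷ l s A w ⟨
    γaux τ l s (A ∷ w)                                ∎
    where
    open ≡-Reasoning
    seen′ : ∀ {B} → B ∈ w → f B ∈ f A ∷ s′ ⇔ B ∈ A ∷ s
    seen′ B∈w = mk⇔ (λ { (here e) → here (f-inj e) ; (there p) → there (to (seen (there B∈w)) p) })
                    (λ { (here refl) → here refl ; (there p) → there (from (seen (there B∈w)) p) })

  γaux-cong-seen : ∀ {m} (l : Fin m → α) {s s′} w → (∀ {B} → B ∈ w → B ∈ s′ ⇔ B ∈ s) →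
                   γaux τ l s′ w ≡ γaux τ l s w
  γaux-cong-seen l {s′ = s′} w seen =
    trans (cong (γaux τ l s′) (sym (map-id w))) (γaux-rename id (λ _ → refl) w seen)

  γaux-pair : ∀ {m} (l : Fin m → α) {A} q r → A ∉ q → A ∉ r →
              γaux τ l [] (A ∷ q ++ A ∷ r) ≡ z (l A) ++ γaux τ l [] q ++ z (τ (l A)) ++ γaux τ l (reverse q ++ []) r
  γaux-pair l {A} q r A∉q A∉r = begin
    γaux τ l [] (A ∷ q ++ A ∷ r)
      ≡⟨ γaux-∷ l [] A (q ++ A ∷ r) ⟩
    γletter l [] A ++ γaux τ l [ A ] (q ++ A ∷ r)
      ≡⟨ cong₂ _++_ (γletter-∉ l {[]} λ ()) (γaux-++ l [ A ] q (A ∷ r)) ⟩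
    z (l A) ++ γaux τ l [ A ] q ++ γaux τ l (reverse q ++ [ A ]) (A ∷ r)
      ≡⟨ cong (λ t → z (l A) ++ γaux τ l [ A ] q ++ t) (γaux-∷ l (reverse q ++ [ A ]) A r) ⟩
    z (l A) ++ γaux τ l [ A ] q ++ γletter l (reverse q ++ [ A ]) A ++ γaux τ l (A ∷ reverse q ++ [ A ]) r
      ≡⟨ cong₂ (λ t t′ → z (l A) ++ t ++ t′)
               (γaux-cong-seen l q seen-q)
               (cong₂ _++_ (γletter-∈ l (∈-++⁺ʳ (reverse q) (here refl))) (γaux-cong-seen l r seen-r)) ⟩
    z (l A) ++ γaux τ l [] q ++ z (τ (l A)) ++ γaux τ l (reverse q ++ []) r
      ∎
    where
    open ≡-Reasoning
    seen-q : ∀ {B} → B ∈ q → B ∈ [ A ] ⇔ B ∈ []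
    seen-q B∈q = mk⇔ (λ { (here refl) → ⊥-elim (A∉q B∈q) }) λ ()
    seen-r : ∀ {B} → B ∈ r → B ∈ A ∷ reverse q ++ [ A ] ⇔ B ∈ reverse q ++ []
    seen-r {B} B∈r = mk⇔ forget-A (λ B∈q → there (∈-++⁺ˡ (subst (B ∈_) (++-identityʳ (reverse q)) B∈q)))
      where
      forget-A : B ∈ A ∷ reverse q ++ [ A ] → B ∈ reverse q ++ []
      forget-A (here refl) = ⊥-elim (A∉r B∈r)
      forget-A (there p) with ∈-++⁻ (reverse q) p
      ... | inj₁ B∈q         = ∈-++⁺ˡ B∈q
      ... | inj₂ (here refl) = ⊥-elim (A∉r B∈r)

  commutator-insert : ∀ a u v → InCommutatorSubgroup τ (u ++ v) →
                      InCommutatorSubgroup τ (z a ++ u ++ z (τ a) ++ v)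
  commutator-insert a u v uv∈ = cs-resp conjugated (cs-mul (cs-comm (z a) u) uv∈)
    where
    conjugated : commW (z a) u ++ u ++ v ≈ z a ++ u ++ z (τ a) ++ v
    conjugated = ≈-trans (commW-++-cancel (z a) u v) (z⁻¹≈z∘τ (z a ++ u) v a)

  γaux-commutator : ∀ {m} (l : Fin m → α) n (w : List (Fin m)) → length w ≤ n → TwiceOrAbsent w →
                    InCommutatorSubgroup τ (γaux τ l [] w)
  γaux-commutator l n       []      _          _     = cs-one
  γaux-commutator l (suc n) (A ∷ w) (s≤s |w|≤n) twice with twice A
  ... | inj₁ zero≡ with () ← trans (sym (occ-∷-≡ A w)) zero≡
  ... | inj₂ two≡
    with q , r , refl ← ∈-∃++ (occ≡suc⇒∈ {A = A} {w} (ℕ-suc-injective (trans (sym (occ-∷-≡ A w)) two≡)))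
    with occA≡0 , twice′ ← twiceOrAbsent-removePair {q = q} twice
    = subst (InCommutatorSubgroup τ) (sym (γaux-pair l q r (λ A∈q → A∉qr (∈-++⁺ˡ A∈q)) (λ A∈r → A∉qr (∈-++⁺ʳ q A∈r))))
        (commutator-insert (l A) (γaux τ l [] q) (γaux τ l (reverse q ++ []) r)
          (subst (InCommutatorSubgroup τ) (γaux-++ l [] q r) (γaux-commutator l n (q ++ r) |qr|≤n twice′)))
    where
    A∉qr : A ∉ q ++ r
    A∉qr = occ≡0⇒∉ occA≡0
    |qr|≤n : length (q ++ r) ≤ n
    |qr|≤n = ≤-trans (n≤1+n _) (subst (_≤ n) (length-++-sucʳ q A r) |w|≤n)

  γ-commutator : ∀ (w : Nanoword α) → InCommutatorSubgroup τ (γ τ w)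
  γ-commutator w = γaux-commutator label (length word) word ≤-refl (λ B → inj₂ (twice B))
    where open Nanoword w

  γ-wrap : ∀ c w → γ τ (wrap c w) ≡ z c ++ γ τ w ++ z (τ c)
  γ-wrap c w = trans (γaux-pair (c ∷ᵛ label) (map Fin.suc word) [] zero∉ λ ())
    (cong (λ t → z c ++ t ++ z (τ c)) (γaux-rename suc-injective (λ _ → refl) word λ _ → mk⇔ (λ ()) λ ()))
    where
    open Nanoword w
    zero∉ : Fin.zero ∉ map Fin.suc word
    zero∉ zero∈ with _ , _ , () ← ∈-map⁻ Fin.suc zero∈

  γ-⊕ : ∀ w₁ w₂ → γ τ (w₁ ⊕ w₂) ≡ γ τ w₁ ++ γ τ w₂
  γ-⊕ w₁ w₂ = trans (γaux-++ (N₁.label ++ᵛ N₂.label) [] (map (_↑ˡ N₂.m) N₁.word) (map (N₁.m ↑ʳ_) N₂.word))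
    (cong₂ _++_
      (γaux-rename (↑ˡ-injective N₂.m _ _) (lookup-++ˡ N₁.label N₂.label) N₁.word λ _ → mk⇔ (λ ()) λ ())
      (γaux-rename (↑ʳ-injective N₁.m _ _) (lookup-++ʳ N₁.label N₂.label) N₂.word λ _ → mk⇔ unseen λ ()))
    where
    module N₁ = Nanoword w₁
    module N₂ = Nanoword w₂
    unseen : ∀ {j} → N₁.m ↑ʳ j ∈ reverse (map (_↑ˡ N₂.m) N₁.word) ++ [] → j ∈ []
    unseen j∈ with ∈-++⁻ (reverse (map (_↑ˡ N₂.m) N₁.word)) j∈
    ... | inj₁ j∈rev = ⊥-elim (↑ʳ∉map↑ˡ _ N₁.word (reverse⁻ j∈rev))
    ... | inj₂ ()

  Realisable : FWord α → Set
  Realisable g = Σ (Nanoword α) λ w → γ τ w ≈ g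

  realisable-resp : ∀ {u v} → u ≈ v → Realisable u → Realisable v
  realisable-resp u≈v (w , γw≈u) = w , ≈-trans γw≈u u≈v

  realisable-[] : Realisable []
  realisable-[] = emptyNanoword , ≈-refl

  realisable-crossing : ∀ c d → Realisable (z c ++ z d ++ z (τ c) ++ z (τ d))
  realisable-crossing c d = crossing c d , ≈-refl

  realisable-wrap : ∀ c {u} → Realisable u → Realisable (z c ++ u ++ z (τ c))
  realisable-wrap c {u} (w , γw≈u) =
    wrap c w , subst (_≈ z c ++ u ++ z (τ c)) (sym (γ-wrap c w)) (++-congˡ (z c) (++-congʳ (z (τ c)) γw≈u))

  realisable-++ : ∀ {u v} → Realisable u → Realisable v → Realisable (u ++ v)
  realisable-++ {u} {v} (w₁ , γw₁≈u) (w₂ , γw₂≈v) =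
    w₁ ⊕ w₂ , subst (_≈ u ++ v) (sym (γ-⊕ w₁ w₂)) (++-cong γw₁≈u γw₂≈v)

  positive : Letter α → α
  positive (true  , a) = a
  positive (false , a) = τ a

  letter≈z : ∀ l → [ l ] ≈ z (positive l)
  letter≈z (true  , a) = ≈-refl
  letter≈z (false , a) = z⁻¹≈z∘τ [] [] a

  module _ (τ-involutive : ∀ a → τ (τ a) ≡ a) where

    invW-pair : ∀ (u v : FWord α) b a c e →
                invW (u ++ (b , a) ∷ (c , e) ∷ v) ≡ invW v ++ (not c , e) ∷ (not b , a) ∷ invW u
    invW-pair u v b a c e = begin
      invW (u ++ (b , a) ∷ (c , e) ∷ v)                              ≡⟨ invW-++ u _ ⟩
      invW ((b , a) ∷ (c , e) ∷ v) ++ invW u                         ≡⟨ cong (_++ invW u) (invW-∷ b a ((c , e) ∷ v)) ⟩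
      (invW ((c , e) ∷ v) ++ [ (not b , a) ]) ++ invW u              ≡⟨ cong (λ t → (t ++ [ (not b , a) ]) ++ invW u) (invW-∷ c e v) ⟩
      ((invW v ++ [ (not c , e) ]) ++ [ (not b , a) ]) ++ invW u     ≡⟨ solve (++-monoid (Letter α)) ⟩
      invW v ++ [ (not c , e) ] ++ [ (not b , a) ] ++ invW u         ∎
      where open ≡-Reasoning

    invW-cong : ∀ {u v} → u ≈ v → invW u ≈ invW v
    invW-cong ≈-refl          = ≈-refl
    invW-cong (≈-sym e)       = ≈-sym (invW-cong e)
    invW-cong (≈-trans e e′)  = ≈-trans (invW-cong e) (invW-cong e′)
    invW-cong (≈-free u v b a) = begin
      invW (u ++ (b , a) ∷ (not b , a) ∷ v)                ≡⟨ invW-pair u v b a (not b) a ⟩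
      invW v ++ (not (not b) , a) ∷ (not b , a) ∷ invW u  ≈⟨ ≈-free⁻ (invW v) (invW u) (not b) a ⟩
      invW v ++ invW u                                    ≡⟨ invW-++ u v ⟨
      invW (u ++ v)                                       ∎
      where open ≈-Reasoning
    invW-cong (≈-rel u v a) = begin
      invW (u ++ (true , a) ∷ (true , τ a) ∷ v)          ≡⟨ invW-pair u v true a true (τ a) ⟩
      invW v ++ (false , τ a) ∷ (false , a) ∷ invW u      ≈⟨ z⁻¹≈z∘τ (invW v) _ (τ a) ⟩
      invW v ++ (true , τ (τ a)) ∷ (false , a) ∷ invW u   ≡⟨ cong (λ c → invW v ++ (true , c) ∷ (false , a) ∷ invW u) (τ-involutive a) ⟩
      invW v ++ (true , a) ∷ (false , a) ∷ invW u         ≈⟨ ≈-free (invW v) (invW u) true a ⟩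
      invW v ++ invW u                                    ≡⟨ invW-++ u v ⟨
      invW (u ++ v)                                       ∎
      where open ≈-Reasoning

    commW-cong : ∀ {x x′ y y′} → x ≈ x′ → y ≈ y′ → commW x y ≈ commW x′ y′
    commW-cong x≈x′ y≈y′ = ++-cong x≈x′ (++-cong y≈y′ (++-cong (invW-cong x≈x′) (invW-cong y≈y′)))

    realisable-conj : ∀ l {u} → Realisable u → Realisable ([ l ] ++ u ++ invW [ l ])
    realisable-conj l {u} realisable-u = realisable-resp conjugate (realisable-wrap (positive l) realisable-u)
      where
      c : α
      c = positive l
      conjugate : z c ++ u ++ z (τ c) ≈ [ l ] ++ u ++ invW [ l ]
      conjugate = ≈-sym (≈-trans (++-cong (letter≈z l) (++-congˡ u (invW-cong (letter≈z l))))
                                 (z⁻¹≈z∘τ (z c ++ u) [] c))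

    realisable-commW-letters : ∀ l d → Realisable (commW [ l ] [ d ])
    realisable-commW-letters l d = realisable-resp (≈-sym generators) (realisable-crossing c e)
      where
      c e : α
      c = positive l
      e = positive d
      generators : commW [ l ] [ d ] ≈ z c ++ z e ++ z (τ c) ++ z (τ e)
      generators = ≈-trans (commW-cong (letter≈z l) (letter≈z d))
                     (≈-trans (z⁻¹≈z∘τ (z c ++ z e) [ (false , e) ] c) (z⁻¹≈z∘τ (z c ++ z e ++ z (τ c)) [] e))

    realisable-commW-letter : ∀ l y → Realisable (commW [ l ] y)
    realisable-commW-letter (b , a) [] = realisable-resp (≈-sym (≈-free [] [] b a)) realisable-[]
    realisable-commW-letter l (d ∷ y) =
      realisable-resp (commW-++ʳ [ l ] [ d ] y)
        (realisable-++ (realisable-commW-letters l d) (realisable-conj d (realisable-commW-letter l y)))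

    realisable-commW : ∀ x y → Realisable (commW x y)
    realisable-commW []      y = realisable-resp (≈-sym (invW-inverseʳ y)) realisable-[]
    realisable-commW (l ∷ x) y =
      realisable-resp (commW-++ˡ [ l ] x y)
        (realisable-++ (realisable-conj l (realisable-commW x y)) (realisable-commW-letter l y))

    -- Carrying the inverse along handles cs-inv without a nanoword for γ(w)⁻¹.
    commutator⇒realisable : ∀ {g} → InCommutatorSubgroup τ g → Realisable g × Realisable (invW g)
    commutator⇒realisable cs-one        = realisable-[] , realisable-[]
    commutator⇒realisable (cs-comm x y) =
      realisable-commW x y , subst Realisable (sym (invW-commW x y)) (realisable-commW y x)
    commutator⇒realisable (cs-mul {u} {v} u∈ v∈)
      with ru , ru⁻¹ ← commutator⇒realisable u∈
      with rv , rv⁻¹ ← commutator⇒realisable v∈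
      = realisable-++ ru rv , subst Realisable (sym (invW-++ u v)) (realisable-++ rv⁻¹ ru⁻¹)
    commutator⇒realisable (cs-inv {u} u∈)
      with ru , ru⁻¹ ← commutator⇒realisable u∈
      = ru⁻¹ , subst Realisable (sym (invW-involutive u)) ru
    commutator⇒realisable (cs-resp u≈v u∈) =
      Product.map (realisable-resp u≈v) (realisable-resp (invW-cong u≈v)) (commutator⇒realisable u∈)

lemma4p1 : (α : Set) (τ : α → α) → (∀ a → τ (τ a) ≡ a) →
           (g : FWord α) →
           (Σ (Nanoword α) (λ w → _≈Π_ τ (γ τ w) g)) ⇔ InCommutatorSubgroup τ g
lemma4p1 α τ τ-involutive g =
  mk⇔ (λ (w , γw≈g) → cs-resp γw≈g (γ-commutator τ w))
      (λ g∈ → proj₁ (commutator⇒realisable τ τ-involutive g∈))
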